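{- Let $\alpha$ be a composition. Call two standard lexical tableaux of shape $\alpha$ row-equivalent if, for each $i$, their $i$-th rows contain the same set of labels. Then the number of equivalence classes of standard lexical tableaux of shape $\alpha$ under row-equivalence equals the number of standard immaculate tableaux of shape $\alpha$.
   Context: A composition $\alpha \vDash n$ is a tuple of positive integers summing to $n$; its diagram has left-justified rows, row $i$ (from the bottom) having $\alpha_i$ cells. A word $w=w_1\cdots w_m$ is a necklace word if it is lexicographically weakly smallest among all its cyclic shifts $w_{i+1}\cdots w_m w_1\cdots w_i$. A standard lexical tableau of shape $\alpha$ is a filling of the diagram of $\alpha$ with $1,\dots,n$, each used once, such that the first column strictly increases from the bottom row upward and each row, read left to right, is a necklace word. A standard immaculate tableau of shape $\alpha$ is a filling of the diagram with $1,\dots,n$, each used once, with strictly increasing first column (from bottom upward) and each row increasing left to right. -}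

module Defs where

open import Data.Nat using (ℕ; zero; suc; _<_; _≤_)
open import Data.List using (List; []; _∷_; length; concat; map; upTo; drop; take; _++_)
open import Data.Nat.ListAction using (sum)
open import Data.List.Relation.Unary.All using (All)
open import Data.List.Relation.Unary.Linked using (Linked)
open import Data.List.Relation.Binary.Pointwise using (Pointwise)
open import Data.List.Relation.Binary.Permutation.Propositional using (_↭_)
open import Data.List.Membership.Propositional using (_∈_)
open import Data.Product using (Σ; _×_; proj₁)
open import Data.Sum using (_⊎_)
open import Data.Empty using (⊥)
open import Data.Unit using (⊤)
open import Relation.Binary.PropositionalEquality using (_≡_)
open import Function.Bundles using (_⇔_)

-- A composition: a list of positive integers (α₁, α₂, …), α₁ = bottom row.
IsComposition : List ℕ → Set
IsComposition α = All (λ a → 1 ≤ a) α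

-- A filling of the diagram of α: a list of rows, listed from the bottom row
-- upward, row i having exactly α_i entries, using each of 1,…,n exactly once
-- (n = sum α).
IsFilling : List ℕ → List (List ℕ) → Set
IsFilling α rows =
  Pointwise (λ r a → length r ≡ a) rows α × (concat rows ↭ map suc (upTo (sum α)))

-- first entry of a row (rows of a filling of a composition are nonempty)
headOr0 : List ℕ → ℕ
headOr0 []      = 0
headOr0 (x ∷ _) = x

FirstColumnIncreasing : List (List ℕ) → Set
FirstColumnIncreasing rows = Linked _<_ (map headOr0 rows)

_≤lex_ : List ℕ → List ℕ → Set
[]       ≤lex _        = ⊤
(_ ∷ _)  ≤lex []       = ⊥
(x ∷ xs) ≤lex (y ∷ ys) = (x < y) ⊎ ((x ≡ y) × (xs ≤lex ys))

rotate : ℕ → List ℕ → List ℕ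
rotate i w = drop i w ++ take i w

IsNecklace : List ℕ → Set
IsNecklace w = ∀ i → i < length w → w ≤lex rotate i w

IsStandardLexical : List ℕ → List (List ℕ) → Set
IsStandardLexical α rows =
  IsFilling α rows × FirstColumnIncreasing rows × All IsNecklace rows

IsStandardImmaculate : List ℕ → List (List ℕ) → Set
IsStandardImmaculate α rows =
  IsFilling α rows × FirstColumnIncreasing rows × All (Linked _<_) rows

SLT : List ℕ → Set
SLT α = Σ (List (List ℕ)) (IsStandardLexical α)

SIT : List ℕ → Set
SIT α = Σ (List (List ℕ)) (IsStandardImmaculate α)

RowEquivalent : {α : List ℕ} → SLT α → SLT α → Set
RowEquivalent S T =
  Pointwise (λ r s → ∀ x → (x ∈ r) ⇔ (x ∈ s)) (proj₁ S) (proj₁ T)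

-- The bijection is "sort every row". A filling uses each label once, so its rows
-- have distinct entries; a strictly increasing word is determined by its set of
-- letters, hence two fillings are row-equivalent exactly when sorting their rows
-- gives the same result. The first letter of a necklace word is its minimum, so
-- sorting a lexical tableau does not change its first column and yields an
-- immaculate tableau. Conversely an increasing word is a necklace, so every
-- immaculate tableau is a lexical tableau that sorting leaves unchanged.
module Submission where

open import Defs
open import Data.Nat using (ℕ; zero; suc; _<_; _≤_; s≤s; z≤n)
open import Data.Nat.Properties
  using (≤-decTotalOrder; ≤-totalOrder; ≤-refl; ≤-trans; ≤-antisym; <-trans; <-irrefl; <⇒≤; ≤∧≢⇒<; suc-injective)
open import Data.List using (List; []; _∷_; length; concat; map; drop; _++_)
open import Data.List.Properties using (++-identityʳ; ∷-injective; map-id-local)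
open import Data.Nat.ListAction using (sum)
open import Data.List.Relation.Unary.All as All using (All; []; _∷_)
open import Data.List.Relation.Unary.All.Properties using (++⁻ˡ)
open import Data.List.Relation.Unary.Any using (here; there)
open import Data.List.Relation.Unary.Linked as Linked using (Linked; []; [-]; _∷_)
open import Data.List.Relation.Unary.Linked.Properties using (Linked⇒All)
open import Data.List.Relation.Unary.Sorted.TotalOrder.Properties using (↗↭↗⇒≋)
open import Data.List.Relation.Binary.Pointwise using (Pointwise; []; _∷_; Pointwise-≡⇒≡)
open import Data.List.Relation.Binary.Permutation.Propositional
  using (_↭_; ↭-refl; ↭-sym; ↭-trans; ↭⇒↭ₛ)
open import Data.List.Relation.Binary.Permutation.Propositional.Properties
  using (∈-resp-↭; ↭-length; ++⁺; ↭-empty-inv; ¬x∷xs↭[])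
open import Data.List.Relation.Binary.Permutation.Setoid.Properties as ↭ₛ using ()
open import Data.List.Relation.Unary.Unique.Propositional using (Unique; []; _∷_)
open import Data.List.Relation.Unary.Unique.Propositional.Properties using (upTo⁺; map⁺)
open import Data.List.Membership.Propositional using (_∈_)
open import Data.Product using (Σ; _×_; proj₁; ∃; _,_)
open import Data.Sum using (inj₁; inj₂)
open import Data.Empty using (⊥-elim)
open import Data.Unit using (tt)
open import Function using (_∘_)
open import Relation.Binary.PropositionalEquality using (_≡_; refl; sym; cong; cong₂; subst; setoid)
open import Function.Bundles using (_⇔_; mk⇔; Equivalence)
open import Data.List.Sort ≤-decTotalOrder using (sort; sort-↭; sort-↗)

open Equivalence using (to; from)

SameElements : List ℕ → List ℕ → Set
SameElements r s = ∀ x → (x ∈ r) ⇔ (x ∈ s)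

Unique-resp-↭ : ∀ {xs ys : List ℕ} → xs ↭ ys → Unique xs → Unique ys
Unique-resp-↭ p = ↭ₛ.Unique-resp-↭ (setoid ℕ) (↭⇒↭ₛ p)

Unique-++⁻ : ∀ {A : Set} (xs : List A) {ys} → Unique (xs ++ ys) → Unique xs × Unique ys
Unique-++⁻ []       u       = [] , u
Unique-++⁻ (_ ∷ xs) (a ∷ u) with Unique-++⁻ xs u
... | uxs , uys = ++⁻ˡ xs a ∷ uxs , uys

Unique-concat⁻ : ∀ {A : Set} (xss : List (List A)) → Unique (concat xss) → All Unique xss
Unique-concat⁻ []         _ = []
Unique-concat⁻ (xs ∷ xss) u with Unique-++⁻ xs u
... | uxs , uxss = uxs ∷ Unique-concat⁻ xss uxss

IsFilling⇒rows-Unique : ∀ {α rows} → IsFilling α rows → All Unique rows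
IsFilling⇒rows-Unique {α} {rows} (_ , perm) =
  Unique-concat⁻ rows (Unique-resp-↭ (↭-sym perm) (map⁺ suc-injective (upTo⁺ (sum α))))

Linked<⇒head<tail : ∀ {x xs} → Linked _<_ (x ∷ xs) → All (x <_) xs
Linked<⇒head<tail [-]        = []
Linked<⇒head<tail (x<y ∷ ys) = Linked⇒All <-trans x<y ys

Linked≤⇒head≤ : ∀ {x xs} → Linked _≤_ (x ∷ xs) → All (x ≤_) (x ∷ xs)
Linked≤⇒head≤ = Linked⇒All ≤-trans ≤-refl

Linked≤∧Unique⇒Linked< : ∀ {xs} → Linked _≤_ xs → Unique xs → Linked _<_ xs
Linked≤∧Unique⇒Linked< []         _                  = []
Linked≤∧Unique⇒Linked< [-]        _                  = [-]
Linked≤∧Unique⇒Linked< (x≤y ∷ xs) ((x≢y ∷ _) ∷ uxs) =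
  ≤∧≢⇒< x≤y x≢y ∷ Linked≤∧Unique⇒Linked< xs uxs

∈-∷∧head<⇒∈ : ∀ {x z} {ys} → z ∈ x ∷ ys → x < z → z ∈ ys
∈-∷∧head<⇒∈ (here refl) x<x = ⊥-elim (<-irrefl refl x<x)
∈-∷∧head<⇒∈ (there z∈) _   = z∈

Linked<∧SameElements⇒≡ : ∀ {xs ys} → Linked _<_ xs → Linked _<_ ys → SameElements xs ys → xs ≡ ys
Linked<∧SameElements⇒≡ {[]}    {[]}    _ _ _ = refl
Linked<∧SameElements⇒≡ {[]}    {y ∷ _} _ _ e with from (e y) (here refl)
... | ()
Linked<∧SameElements⇒≡ {x ∷ _} {[]}    _ _ e with to (e x) (here refl)
... | ()
Linked<∧SameElements⇒≡ {x ∷ xs} {y ∷ ys} <xs <ys e with x≡y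
  where
  x≡y : x ≡ y
  x≡y = ≤-antisym (All.lookup (Linked≤⇒head≤ (Linked.map <⇒≤ <xs)) (from (e y) (here refl)))
                  (All.lookup (Linked≤⇒head≤ (Linked.map <⇒≤ <ys)) (to (e x) (here refl)))
... | refl = cong (x ∷_) (Linked<∧SameElements⇒≡ (Linked.tail <xs) (Linked.tail <ys) tails)
  where
  tails : SameElements xs ys
  tails z = mk⇔
    (λ z∈ → ∈-∷∧head<⇒∈ (to (e z) (there z∈)) (All.lookup (Linked<⇒head<tail <xs) z∈))
    (λ z∈ → ∈-∷∧head<⇒∈ (from (e z) (there z∈)) (All.lookup (Linked<⇒head<tail <ys) z∈))

∈-sort⇔ : ∀ xs → SameElements xs (sort xs)
∈-sort⇔ xs z = mk⇔ (∈-resp-↭ (↭-sym (sort-↭ xs))) (∈-resp-↭ (sort-↭ xs))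

sort-Linked< : ∀ {xs} → Unique xs → Linked _<_ (sort xs)
sort-Linked< {xs} u = Linked≤∧Unique⇒Linked< (sort-↗ xs) (Unique-resp-↭ (↭-sym (sort-↭ xs)) u)

sort-sorted : ∀ {xs} → Linked _≤_ xs → sort xs ≡ xs
sort-sorted {xs} ≤xs =
  Pointwise-≡⇒≡ (↗↭↗⇒≋ ≤-totalOrder (sort-↗ xs) ≤xs (↭⇒↭ₛ (sort-↭ xs)))

SameElements⇒sort≡ : ∀ {r s} → Unique r → Unique s → SameElements r s → sort r ≡ sort s
SameElements⇒sort≡ {r} {s} ur us e =
  Linked<∧SameElements⇒≡ (sort-Linked< ur) (sort-Linked< us) λ z → mk⇔
    (to (∈-sort⇔ s z) ∘ to (e z) ∘ from (∈-sort⇔ r z))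
    (to (∈-sort⇔ r z) ∘ from (e z) ∘ from (∈-sort⇔ s z))

sort≡⇒SameElements : ∀ {r s} → sort r ≡ sort s → SameElements r s
sort≡⇒SameElements {r} {s} eq z = mk⇔
  (from (∈-sort⇔ s z) ∘ subst (z ∈_) eq ∘ to (∈-sort⇔ r z))
  (from (∈-sort⇔ r z) ∘ subst (z ∈_) (sym eq) ∘ to (∈-sort⇔ s z))

sort-head : ∀ {x t} → All (x ≤_) (x ∷ t) → headOr0 (sort (x ∷ t)) ≡ x
sort-head {x} {t} x≤ with sort (x ∷ t) | sort-↭ (x ∷ t) | sort-↗ (x ∷ t)
... | []    | p | _   = ⊥-elim (¬x∷xs↭[] (↭-sym p))
... | y ∷ _ | p | ≤ys = ≤-antisym
  (All.lookup (Linked≤⇒head≤ ≤ys) (∈-resp-↭ (↭-sym p) (here refl)))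
  (All.lookup x≤ (∈-resp-↭ p (here refl)))

≤lex-refl : ∀ w → w ≤lex w
≤lex-refl []      = tt
≤lex-refl (x ∷ w) = inj₂ (refl , ≤lex-refl w)

≤lex⇒head≤ : ∀ {x y xs ys} → (x ∷ xs) ≤lex (y ∷ ys) → x ≤ y
≤lex⇒head≤ (inj₁ x<y)        = <⇒≤ x<y
≤lex⇒head≤ (inj₂ (refl , _)) = ≤-refl

drop-<length : ∀ j (t : List ℕ) → j < length t → ∃ λ y → ∃ λ rest → drop j t ≡ y ∷ rest × y ∈ t
drop-<length zero    (y ∷ t) _       = y , t , refl , here refl
drop-<length (suc j) (_ ∷ t) (s≤s j<) with drop-<length j t j<
... | y , rest , eq , y∈ = y , rest , eq , there y∈

∈⇒drop≡ : ∀ {z : ℕ} {t} → z ∈ t → ∃ λ j → ∃ λ rest → j < length t × drop j t ≡ z ∷ rest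
∈⇒drop≡ {t = _ ∷ t} (here refl) = 0 , t , s≤s z≤n , refl
∈⇒drop≡ (there z∈) with ∈⇒drop≡ z∈
... | j , rest , j< , eq = suc j , rest , s≤s j< , eq

Linked<⇒IsNecklace : ∀ {w} → Linked _<_ w → IsNecklace w
Linked<⇒IsNecklace {x ∷ t} _ zero _ =
  subst ((x ∷ t) ≤lex_) (sym (++-identityʳ (x ∷ t))) (≤lex-refl (x ∷ t))
Linked<⇒IsNecklace {x ∷ t} <w (suc j) (s≤s j<) with drop-<length j t j<
... | y , rest , eq , y∈ rewrite eq = inj₁ (All.lookup (Linked<⇒head<tail <w) y∈)

-- the rotation starting at any letter z is lexicographically at least w, so w₁ ≤ z
IsNecklace⇒head≤ : ∀ {x t} → IsNecklace (x ∷ t) → All (x ≤_) (x ∷ t)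
IsNecklace⇒head≤ {x} {t} neck = All.tabulate λ z∈ → headOfRotation (∈⇒drop≡ z∈)
  where
  headOfRotation : ∀ {z} → ∃ (λ j → ∃ λ rest → j < length (x ∷ t) × drop j (x ∷ t) ≡ z ∷ rest) → x ≤ z
  headOfRotation (j , rest , j< , eq) with neck j j<
  ... | lex rewrite eq = ≤lex⇒head≤ lex

sort-IsNecklace-head : ∀ {w} → IsNecklace w → headOr0 (sort w) ≡ headOr0 w
sort-IsNecklace-head {[]}    _    = cong headOr0 (↭-empty-inv (sort-↭ []))
sort-IsNecklace-head {_ ∷ _} neck = sort-head (IsNecklace⇒head≤ neck)

sortRows : List (List ℕ) → List (List ℕ)
sortRows = map sort

sortRows-lengths : ∀ {rows} {α : List ℕ} → Pointwise (λ r a → length r ≡ a) rows α →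
  Pointwise (λ r a → length r ≡ a) (sortRows rows) α
sortRows-lengths []                    = []
sortRows-lengths {r ∷ _} (refl ∷ lens) = ↭-length (sort-↭ r) ∷ sortRows-lengths lens

concat-sortRows-↭ : ∀ rows → concat (sortRows rows) ↭ concat rows
concat-sortRows-↭ []         = ↭-refl
concat-sortRows-↭ (r ∷ rows) = ++⁺ (sort-↭ r) (concat-sortRows-↭ rows)

sortRows-heads : ∀ {rows} → All IsNecklace rows → map headOr0 (sortRows rows) ≡ map headOr0 rows
sortRows-heads []             = refl
sortRows-heads (neck ∷ necks) = cong₂ _∷_ (sort-IsNecklace-head neck) (sortRows-heads necks)

sortRows-Linked< : ∀ {rows} → All Unique rows → All (Linked _<_) (sortRows rows)
sortRows-Linked< []       = []
sortRows-Linked< (u ∷ us) = sort-Linked< u ∷ sortRows-Linked< us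

sortRows-id : ∀ {rows} → All (Linked _<_) rows → sortRows rows ≡ rows
sortRows-id = map-id-local ∘ All.map (sort-sorted ∘ Linked.map <⇒≤)

rowwise-SameElements⇔sortRows≡ : ∀ {rs ss} → All Unique rs → All Unique ss →
  Pointwise SameElements rs ss ⇔ (sortRows rs ≡ sortRows ss)
rowwise-SameElements⇔sortRows≡ urs uss = mk⇔ (⇒ urs uss) (⇐ _ _)
  where
  ⇒ : ∀ {rs ss} → All Unique rs → All Unique ss → Pointwise SameElements rs ss → sortRows rs ≡ sortRows ss
  ⇒ [] [] [] = refl
  ⇒ (ur ∷ urs) (us ∷ uss) (e ∷ es) = cong₂ _∷_ (SameElements⇒sort≡ ur us e) (⇒ urs uss es)
  ⇐ : ∀ rs ss → sortRows rs ≡ sortRows ss → Pointwise SameElements rs ss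
  ⇐ []       []       _  = []
  ⇐ (r ∷ rs) (s ∷ ss) eq with ∷-injective eq
  ... | eq₁ , eqs = sort≡⇒SameElements eq₁ ∷ ⇐ rs ss eqs

sortTableau : ∀ α → SLT α → SIT α
sortTableau α (rows , (lens , perm) , firstCol , necks) =
  sortRows rows ,
  (sortRows-lengths lens , ↭-trans (concat-sortRows-↭ rows) perm) ,
  subst (Linked _<_) (sym (sortRows-heads necks)) firstCol ,
  sortRows-Linked< (IsFilling⇒rows-Unique (lens , perm))

immaculate⇒lexical : ∀ {α} → SIT α → SLT α
immaculate⇒lexical (rows , filling , firstCol , incr) =
  rows , filling , firstCol , All.map Linked<⇒IsNecklace incr

theorem3p6 : (α : List ℕ) → IsComposition α →
    Σ (SLT α → SIT α) λ g →
      (∀ (S T : SLT α) → RowEquivalent S T ⇔ (proj₁ (g S) ≡ proj₁ (g T)))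
      × (∀ (U : SIT α) → ∃ λ (S : SLT α) → proj₁ (g S) ≡ proj₁ U)
theorem3p6 α _ = sortTableau α , rowEquivalence , surjective
  where
  rowEquivalence : ∀ (S T : SLT α) → RowEquivalent S T ⇔ (proj₁ (sortTableau α S) ≡ proj₁ (sortTableau α T))
  rowEquivalence (_ , fillS , _) (_ , fillT , _) =
    rowwise-SameElements⇔sortRows≡ (IsFilling⇒rows-Unique fillS) (IsFilling⇒rows-Unique fillT)
  surjective : ∀ (U : SIT α) → ∃ λ (S : SLT α) → proj₁ (sortTableau α S) ≡ proj₁ U
  surjective U@(_ , _ , _ , incr) = immaculate⇒lexical U , sortRows-id incr
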